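{- For any graph $G$ with at least one edge, $d_0(G)=\operatorname{sep}(G)$.
   Context: All graphs are finite and simple. For a graph $G$, the $k$-dominating graph $D_k(G)$ has as vertices the dominating sets of $G$ of cardinality at most $k$, two such sets being adjacent if and only if one can be obtained from the other by adding or deleting a single vertex. $d_0(G)$ denotes the smallest integer such that $D_k(G)$ is connected for all $k\geq d_0(G)$. Let $\mathcal{D}(G)$ be the collection of all minimal dominating sets of $G$. For a partition $\Pi=\mathcal{X}\cup\mathcal{Y}$ of $\mathcal{D}(G)$ into two nonempty subcollections, $\operatorname{sep}(\Pi)=\min\{|X\cup Y|: X\in\mathcal{X}, Y\in\mathcal{Y}\}$, and $\operatorname{sep}(G)=\max\{\operatorname{sep}(\Pi)\}$, the maximum taken over all partitions $\Pi$ of $\mathcal{D}(G)$ into two nonempty subcollections. -}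

module Defs where

open import Data.Nat using (ℕ; _≤_)
open import Data.Bool using (Bool; true; false)
open import Data.Fin using (Fin)
open import Data.Fin.Subset using (Subset; _∈_; _∉_; _⊂_; _∪_; ⁅_⁆; ∣_∣)
open import Data.Product using (Σ; ∃; _×_; _,_)
open import Data.Sum using (_⊎_)
open import Relation.Nullary using (¬_)
open import Relation.Binary.PropositionalEquality using (_≡_)

record Graph (n : ℕ) : Set where
  field
    adj     : Fin n → Fin n → Bool
    sym     : ∀ u v → adj u v ≡ adj v u
    irrefl  : ∀ v → adj v v ≡ false
open Graph public

HasEdge : ∀ {n} → Graph n → Set
HasEdge G = ∃ λ u → ∃ λ v → adj G u v ≡ true

Dominating : ∀ {n} → Graph n → Subset n → Set
Dominating G S = ∀ v → v ∈ S ⊎ (∃ λ u → u ∈ S × adj G u v ≡ true)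

MinimalDominating : ∀ {n} → Graph n → Subset n → Set
MinimalDominating G S = Dominating G S × (∀ T → T ⊂ S → ¬ Dominating G T)

InDk : ∀ {n} → Graph n → ℕ → Subset n → Set
InDk G k S = Dominating G S × ∣ S ∣ ≤ k

AddOne : ∀ {n} → Subset n → Subset n → Set
AddOne A B = ∃ λ v → v ∉ A × B ≡ A ∪ ⁅ v ⁆

AdjDk : ∀ {n} → Subset n → Subset n → Set
AdjDk A B = AddOne A B ⊎ AddOne B A

data Reach {n} (G : Graph n) (k : ℕ) : Subset n → Subset n → Set where
  here : ∀ {A} → Reach G k A A
  step : ∀ {A B C} → InDk G k B → AdjDk A B → Reach G k B C → Reach G k A C

Connected : ∀ {n} → Graph n → ℕ → Set
Connected G k = ∀ A B → InDk G k A → InDk G k B → Reach G k A B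

IsD0 : ∀ {n} → Graph n → ℕ → Set
IsD0 G d = (∀ k → d ≤ k → Connected G k)
         × (∀ d′ → (∀ k → d′ ≤ k → Connected G k) → d ≤ d′)

-- A partition Π = 𝒳 ∪ 𝒴 of 𝒟(G) is given by a side-function π:
-- 𝒳 = minimal dominating sets X with π X ≡ true, 𝒴 = those with π Y ≡ false.
IsSepΠ : ∀ {n} → Graph n → (Subset n → Bool) → ℕ → Set
IsSepΠ G π s =
  (∃ λ X → ∃ λ Y → MinimalDominating G X × π X ≡ true
                 × MinimalDominating G Y × π Y ≡ false
                 × ∣ X ∪ Y ∣ ≡ s)
  × (∀ X Y → MinimalDominating G X → π X ≡ true
           → MinimalDominating G Y → π Y ≡ false → s ≤ ∣ X ∪ Y ∣)

IsSep : ∀ {n} → Graph n → ℕ → Set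
IsSep G s = (∃ λ π → IsSepΠ G π s)
          × (∀ π s′ → IsSepΠ G π s′ → s′ ≤ s)

-- Both d₀(G) and sep(G) equal the least s for which the minimal dominating
-- sets are connected under the relation |X ∪ Y| ≤ s.  Above s, any two
-- dominating sets are joined in D_k(G) by shrinking to minimal dominating
-- sets, following such a chain X — X ∪ Y — Y, and growing back.  At s − 1
-- the component of one minimal dominating set is a partition Π with
-- sep(Π) = s, every partition has a crossing pair on a chain of level s, and
-- no walk in D_{s−1}(G) can leave the sets containing a minimal dominating
-- set of the component, since a set of size ≤ s − 1 cannot contain minimal
-- dominating sets from both sides.  An edge uv yields two distinct minimal
-- dominating sets (one avoiding u, one inside V ∖ N(u), hence containing u),
-- so s ≥ 1.
module Submission where

open import Defs
open import Data.Bool using (Bool; true; false; not; if_then_else_) renaming (_≟_ to _≟ᵇ_)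
open import Data.Empty using (⊥; ⊥-elim)
open import Data.Fin using (Fin) renaming (_≟_ to _≟ᶠ_)
open import Data.Fin.Properties using (any?; all?)
open import Data.Fin.Subset
  using (Subset; _∈_; _∉_; _⊆_; _∪_; ⁅_⁆; ∁; ⊤; ∣_∣)
open import Data.Fin.Subset.Properties
  using (_∈?_; _⊂?_; anySubset?; ⊆-refl; ⊆-trans; ⊆-antisym; p⊂q⇒p⊆q;
         p⊆q⇒∣p∣≤∣q∣; p⊂q⇒∣p∣<∣q∣; p⊆p∪q; q⊆p∪q; x∈p∪q⁻; ∪-comm;
         ∣p∣≤n; x∈⁅x⁆; x∈⁅y⁆⇒x≡y; x≢y⇒x∉⁅y⁆; x∈∁p⇒x∉p; x∉p⇒x∈∁p;
         x∈p⇒∣p-x∣<∣p∣; ∈⊤)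
open import Data.Nat using (ℕ; zero; suc; _+_; _∸_; _≤_; _<_; _≤?_; z≤n; s≤s)
open import Data.Nat.Induction using (<-wellFounded)
open import Data.Nat.Properties
  using (≤-refl; ≤-trans; ≤-antisym; ≤-pred; ≰⇒>; 1+n≰n; m≤m+n; m≤n+m;
         +-mono-≤; +-mono-<-≤; +-mono-≤-<; ∸-monoʳ-<)
open import Data.Product using (Σ; ∃; ∃₂; _×_; _,_; proj₁; proj₂)
open import Data.Sum using (_⊎_; inj₁; inj₂)
import Data.Sum as Sum
open import Data.Vec using ([]; _∷_; tabulate)
open import Data.Vec.Properties using (≡-dec; lookup⇒[]=; []=⇒lookup; lookup∘tabulate)
open import Function using (_∘_)
open import Induction.WellFounded using (Acc; acc)
open import Relation.Binary using (Rel; Decidable)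
open import Relation.Binary.Construct.Closure.ReflexiveTransitive using (Star; ε; _◅_; _◅◅_; reverse)
open import Relation.Binary.PropositionalEquality
  using (_≡_; _≢_; refl; trans; cong; subst) renaming (sym to ≡-sym)
open import Relation.Nullary using (¬_; Dec; yes; no; ¬?)
open import Relation.Nullary.Decidable using (_×-dec_; _⊎-dec_; _→-dec_; decidable-stable)

_≟ˢ_ : ∀ {n} → Decidable {A = Subset n} _≡_
_≟ˢ_ = ≡-dec _≟ᵇ_

countSubsets : ∀ {n} → (Subset n → Bool) → ℕ
countSubsets {zero}  f = if f [] then 1 else 0
countSubsets {suc n} f = countSubsets (f ∘ (true ∷_)) + countSubsets (f ∘ (false ∷_))

countSubsets-mono : ∀ {n} (f g : Subset n → Bool) →
  (∀ x → f x ≡ true → g x ≡ true) → countSubsets f ≤ countSubsets g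
countSubsets-mono {zero} f g f⇒g with f [] in fx
... | true rewrite f⇒g [] fx = ≤-refl
... | false = z≤n
countSubsets-mono {suc n} f g f⇒g =
  +-mono-≤ (countSubsets-mono _ _ (f⇒g ∘ (true ∷_))) (countSubsets-mono _ _ (f⇒g ∘ (false ∷_)))

countSubsets-< : ∀ {n} (f g : Subset n → Bool) → (∀ x → f x ≡ true → g x ≡ true) →
  ∀ y → f y ≡ false → g y ≡ true → countSubsets f < countSubsets g
countSubsets-< {zero} f g f⇒g [] fy gy rewrite fy | gy = s≤s z≤n
countSubsets-< {suc n} f g f⇒g (true ∷ y) fy gy =
  +-mono-<-≤ (countSubsets-< _ _ (f⇒g ∘ (true ∷_)) y fy gy)
             (countSubsets-mono _ _ (f⇒g ∘ (false ∷_)))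
countSubsets-< {suc n} f g f⇒g (false ∷ y) fy gy =
  +-mono-≤-< (countSubsets-mono _ _ (f⇒g ∘ (true ∷_)))
             (countSubsets-< _ _ (f⇒g ∘ (false ∷_)) y fy gy)

countSubsets-pos : ∀ {n} (f : Subset n → Bool) y → f y ≡ true → 0 < countSubsets f
countSubsets-pos {zero}  f []         fy rewrite fy = s≤s z≤n
countSubsets-pos {suc n} f (true ∷ y)  fy = ≤-trans (countSubsets-pos _ y fy) (m≤m+n _ _)
countSubsets-pos {suc n} f (false ∷ y) fy = ≤-trans (countSubsets-pos _ y fy) (m≤n+m _ _)

Star-crossing : ∀ {a ℓ} {A : Set a} {R : Rel A ℓ} (f : A → Bool) {x y} →
  Star R x y → f x ≡ true → f y ≡ false → ∃₂ λ z w → R z w × f z ≡ true × f w ≡ false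
Star-crossing f ε fx fy with trans (≡-sym fx) fy
... | ()
Star-crossing f {x} (_◅_ {j = z} r rs) fx fy with f z in fz
... | true  = Star-crossing f rs fz fy
... | false = x , z , r , fx , fz

module Component {n ℓ} {R : Rel (Subset n) ℓ} (R? : Decidable R) (x₀ : Subset n) where

  Reachable : (Subset n → Bool) → Set ℓ
  Reachable c = ∀ z → c z ≡ true → Star R x₀ z

  Closed : (Subset n → Bool) → Set ℓ
  Closed c = ∀ z w → c z ≡ true → c w ≡ false → ¬ R z w

  private
    insert : Subset n → (Subset n → Bool) → Subset n → Bool
    insert w c x with x ≟ˢ w
    ... | yes _ = true
    ... | no  _ = c x

    insert-⊇ : ∀ w c x → c x ≡ true → insert w c x ≡ true
    insert-⊇ w c x cx with x ≟ˢ w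
    ... | yes _ = refl
    ... | no  _ = cx

    insert-∋ : ∀ w c → insert w c w ≡ true
    insert-∋ w c with w ≟ˢ w
    ... | yes _  = refl
    ... | no w≢w = ⊥-elim (w≢w refl)

    insert-⊆ : ∀ w c x → insert w c x ≡ true → c x ≡ true ⊎ x ≡ w
    insert-⊆ w c x e with x ≟ˢ w
    ... | yes x≡w = inj₂ x≡w
    ... | no  _   = inj₁ e

    grow : ∀ fuel c → c x₀ ≡ true → Reachable c → countSubsets (not ∘ c) ≤ fuel →
           Σ (Subset n → Bool) λ c′ → c′ x₀ ≡ true × Reachable c′ × Closed c′
    grow fuel c c₀ reach bound
      with anySubset? (λ z → anySubset? (λ w → (c z ≟ᵇ true) ×-dec (c w ≟ᵇ false) ×-dec R? z w))
    ... | no ∄ = c , c₀ , reach , λ z w cz cw r → ∄ (z , w , cz , cw , r)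
    grow zero c c₀ reach bound | yes (_ , w , _ , cw , _) =
      ⊥-elim (1+n≰n (≤-trans (countSubsets-pos (not ∘ c) w (cong not cw)) bound))
    grow (suc fuel) c c₀ reach bound | yes (z , w , cz , cw , r) =
      grow fuel (insert w c) (insert-⊇ w c x₀ c₀) reach′ (≤-pred (≤-trans fewer bound))
      where
        reach′ : Reachable (insert w c)
        reach′ x e with insert-⊆ w c x e
        ... | inj₁ cx   = reach x cx
        ... | inj₂ refl = reach z cz ◅◅ (r ◅ ε)
        fewer : countSubsets (not ∘ insert w c) < countSubsets (not ∘ c)
        fewer = countSubsets-< (not ∘ insert w c) (not ∘ c)
          subsetᶜ w (cong not (insert-∋ w c)) (cong not cw)
          where
            subsetᶜ : ∀ x → not (insert w c x) ≡ true → not (c x) ≡ true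
            subsetᶜ x e with c x in cx
            ... | false = refl
            ... | true with insert w c x | insert-⊇ w c x cx
            ...   | .true | refl = e

  component : Σ (Subset n → Bool) λ c → c x₀ ≡ true × Reachable c × Closed c
  component = grow _ (insert x₀ (λ _ → false)) (insert-∋ x₀ _) onlyX₀ ≤-refl
    where
      onlyX₀ : Reachable (insert x₀ (λ _ → false))
      onlyX₀ z e with insert-⊆ x₀ _ z e
      ... | inj₂ refl = ε

⊆-or-witness : ∀ {n} (p q : Subset n) → p ⊆ q ⊎ ∃ λ x → x ∈ p × x ∉ q
⊆-or-witness p q with any? (λ x → (x ∈? p) ×-dec ¬? (x ∈? q))
... | yes x = inj₂ x
... | no ∄  = inj₁ λ {x} x∈p → decidable-stable (x ∈? q) (λ x∉q → ∄ (x , x∈p , x∉q))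

∪-least : ∀ {n} {p q r : Subset n} → p ⊆ r → q ⊆ r → p ∪ q ⊆ r
∪-least {p = p} {q} p⊆r q⊆r x∈ = Sum.[ p⊆r , q⊆r ] (x∈p∪q⁻ p q x∈)

∣p∣≤0⇒x∉p : ∀ {n} {p : Subset n} {x} → ∣ p ∣ ≤ 0 → x ∉ p
∣p∣≤0⇒x∉p ∣p∣≤0 x∈p with ≤-trans (x∈p⇒∣p-x∣<∣p∣ x∈p) ∣p∣≤0
... | ()

allSubsets? : ∀ {n ℓ} {P : Subset n → Set ℓ} → (∀ p → Dec (P p)) → Dec (∀ p → P p)
allSubsets? P? with anySubset? (¬? ∘ P?)
... | yes (p , ¬Pp) = no λ ∀P → ¬Pp (∀P p)
... | no ∄          = yes λ p → decidable-stable (P? p) (λ ¬Pp → ∄ (p , ¬Pp))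

∈-tabulate⁺ : ∀ {n} (f : Fin n → Bool) {x} → f x ≡ true → x ∈ tabulate f
∈-tabulate⁺ f {x} fx = lookup⇒[]= x (tabulate f) (trans (lookup∘tabulate f x) fx)

∈-tabulate⁻ : ∀ {n} (f : Fin n → Bool) {x} → x ∈ tabulate f → f x ≡ true
∈-tabulate⁻ f {x} x∈ = trans (≡-sym (lookup∘tabulate f x)) ([]=⇒lookup x∈)

module _ {n} (G : Graph n) where

  dominating? : ∀ S → Dec (Dominating G S)
  dominating? S = all? λ v → (v ∈? S) ⊎-dec any? (λ u → (u ∈? S) ×-dec (adj G u v ≟ᵇ true))

  minimalDominating? : ∀ S → Dec (MinimalDominating G S)
  minimalDominating? S =
    dominating? S ×-dec allSubsets? (λ T → (T ⊂? S) →-dec ¬? (dominating? T))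

  Dominating-⊆ : ∀ {S T} → S ⊆ T → Dominating G S → Dominating G T
  Dominating-⊆ S⊆T dom v = Sum.map S⊆T (λ (u , u∈S , uv) → u , S⊆T u∈S , uv) (dom v)

  minimal-⊆ : ∀ {S} → Dominating G S → ∃ λ M → MinimalDominating G M × M ⊆ S
  minimal-⊆ {S} = descend (<-wellFounded ∣ S ∣)
    where
      descend : ∀ {S} → Acc _<_ ∣ S ∣ → Dominating G S → ∃ λ M → MinimalDominating G M × M ⊆ S
      descend {S} (acc rec) domS with anySubset? (λ T → (T ⊂? S) ×-dec dominating? T)
      ... | no ∄ = S , (domS , λ T T⊂S domT → ∄ (T , T⊂S , domT)) , ⊆-refl
      ... | yes (T , T⊂S , domT) with descend (rec (p⊂q⇒∣p∣<∣q∣ T⊂S)) domT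
      ...   | M , minM , M⊆T = M , minM , ⊆-trans M⊆T (p⊂q⇒p⊆q T⊂S)

  minimal-⊇⇒≡ : ∀ {M S} → MinimalDominating G M → Dominating G S → S ⊆ M → S ≡ M
  minimal-⊇⇒≡ {M} {S} (_ , minimal) domS S⊆M with ⊆-or-witness M S
  ... | inj₁ M⊆S = ⊆-antisym S⊆M M⊆S
  ... | inj₂ x   = ⊥-elim (minimal S (S⊆M , x) domS)

  minimal-∣M∣<∣M∪S∣ : ∀ {M S} → MinimalDominating G M → Dominating G S → S ≢ M → ∣ M ∣ < ∣ M ∪ S ∣
  minimal-∣M∣<∣M∪S∣ {M} {S} minM domS S≢M with ⊆-or-witness S M
  ... | inj₁ S⊆M = ⊥-elim (S≢M (minimal-⊇⇒≡ minM domS S⊆M))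
  ... | inj₂ (x , x∈S , x∉M) = p⊂q⇒∣p∣<∣q∣ (p⊆p∪q S , x , q⊆p∪q M S x∈S , x∉M)

  no-loop : ∀ u → adj G u u ≢ true
  no-loop u e with trans (≡-sym e) (irrefl G u)
  ... | ()

  Neighbours : Fin n → Subset n
  Neighbours u = tabulate (adj G u)

  ∁⁅u⁆-dominating : ∀ {u v} → adj G u v ≡ true → Dominating G (∁ ⁅ u ⁆)
  ∁⁅u⁆-dominating {u} {v} uv w with w ≟ᶠ u
  ... | yes refl = inj₂ (v , x∉p⇒x∈∁p (x≢y⇒x∉⁅y⁆ v≢u) , trans (Graph.sym G v u) uv)
    where
      v≢u : v ≢ u
      v≢u refl = no-loop v uv
  ... | no w≢u = inj₁ (x∉p⇒x∈∁p (x≢y⇒x∉⁅y⁆ w≢u))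

  ∁Neighbours-dominating : ∀ u → Dominating G (∁ (Neighbours u))
  ∁Neighbours-dominating u w with adj G u w in uw
  ... | true  = inj₂ (u , x∉p⇒x∈∁p (no-loop u ∘ ∈-tabulate⁻ (adj G u)) , uw)
  ... | false = inj₁ (x∉p⇒x∈∁p λ w∈ → false≢true (trans (≡-sym uw) (∈-tabulate⁻ (adj G u) w∈)))
    where
      false≢true : false ≢ true
      false≢true ()

  ⊆∁Neighbours⇒∋ : ∀ {u S} → Dominating G S → S ⊆ ∁ (Neighbours u) → u ∈ S
  ⊆∁Neighbours⇒∋ {u} domS S⊆ with domS u
  ... | inj₁ u∈S = u∈S
  ... | inj₂ (x , x∈S , xu) =
    ⊥-elim (x∈∁p⇒x∉p (S⊆ x∈S) (∈-tabulate⁺ (adj G u) (trans (Graph.sym G u x) xu)))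

  two-minimal : HasEdge G → ∃₂ λ M₁ M₂ → MinimalDominating G M₁ × MinimalDominating G M₂ × M₁ ≢ M₂
  two-minimal (u , v , uv)
    with minimal-⊆ (∁⁅u⁆-dominating uv) | minimal-⊆ (∁Neighbours-dominating u)
  ... | M₁ , min₁ , M₁⊆ | M₂ , min₂ , M₂⊆ = M₁ , M₂ , min₁ , min₂ , λ M₁≡M₂ →
    x∈∁p⇒x∉p (M₁⊆ (subst (u ∈_) (≡-sym M₁≡M₂) (⊆∁Neighbours⇒∋ (proj₁ min₂) M₂⊆))) (x∈⁅x⁆ u)

  Reach-trans : ∀ {k A B C} → Reach G k A B → Reach G k B C → Reach G k A C
  Reach-trans here           q = q
  Reach-trans (step inB ab p) q = step inB ab (Reach-trans p q)

  Reach-sym : ∀ {k A B} → InDk G k A → Reach G k A B → Reach G k B A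
  Reach-sym inA here            = here
  Reach-sym inA (step inB ab p) = Reach-trans (Reach-sym inB p) (step inA (Sum.swap ab) here)

  Reach-⊆ : ∀ {k S T} → S ⊆ T → Dominating G S → InDk G k T → Reach G k S T
  Reach-⊆ {k} {S} {T} = climb (<-wellFounded (∣ T ∣ ∸ ∣ S ∣))
    where
      climb : ∀ {S} → Acc _<_ (∣ T ∣ ∸ ∣ S ∣) → S ⊆ T → Dominating G S → InDk G k T → Reach G k S T
      climb {S} (acc rec) S⊆T domS inT with ⊆-or-witness T S
      ... | inj₁ T⊆S = subst (Reach G k S) (⊆-antisym S⊆T T⊆S) here
      ... | inj₂ (x , x∈T , x∉S) =
        step (domS′ , ≤-trans (p⊆q⇒∣p∣≤∣q∣ S′⊆T) (proj₂ inT)) (inj₁ (x , x∉S , refl))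
             (climb (rec (∸-monoʳ-< grows (p⊆q⇒∣p∣≤∣q∣ S′⊆T))) S′⊆T domS′ inT)
        where
          S′⊆T : S ∪ ⁅ x ⁆ ⊆ T
          S′⊆T = ∪-least S⊆T (λ y∈ → subst (_∈ T) (≡-sym (x∈⁅y⁆⇒x≡y x y∈)) x∈T)
          domS′ : Dominating G (S ∪ ⁅ x ⁆)
          domS′ = Dominating-⊆ (p⊆p∪q ⁅ x ⁆) domS
          grows : ∣ S ∣ < ∣ S ∪ ⁅ x ⁆ ∣
          grows = p⊂q⇒∣p∣<∣q∣ (p⊆p∪q ⁅ x ⁆ , x , q⊆p∪q S ⁅ x ⁆ (x∈⁅x⁆ x) , x∉S)

  Reach-via-∪ : ∀ {k Z W} → Dominating G Z → Dominating G W → ∣ Z ∪ W ∣ ≤ k → Reach G k Z W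
  Reach-via-∪ {Z = Z} {W} domZ domW Z∪W≤k =
    Reach-trans (Reach-⊆ (p⊆p∪q W) domZ inZ∪W)
                (Reach-sym inW (Reach-⊆ (q⊆p∪q Z W) domW inZ∪W))
    where
      inZ∪W : InDk G _ (Z ∪ W)
      inZ∪W = Dominating-⊆ (p⊆p∪q W) domZ , Z∪W≤k
      inW : InDk G _ W
      inW = domW , ≤-trans (p⊆q⇒∣p∣≤∣q∣ (q⊆p∪q Z W)) Z∪W≤k

  AddOne⇒⊆ : ∀ {A B : Subset n} → AddOne A B → A ⊆ B
  AddOne⇒⊆ {A} (v , _ , B≡A∪v) = subst (A ⊆_) (≡-sym B≡A∪v) (p⊆p∪q ⁅ v ⁆)

  Near : ℕ → Subset n → Subset n → Set
  Near k Z W = MinimalDominating G Z × MinimalDominating G W × ∣ Z ∪ W ∣ ≤ k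

  near? : ∀ k → Decidable (Near k)
  near? k Z W = minimalDominating? Z ×-dec minimalDominating? W ×-dec (∣ Z ∪ W ∣ ≤? k)

  Near-sym : ∀ {k Z W} → Near k Z W → Near k W Z
  Near-sym {k} {Z} {W} (minZ , minW , Z∪W≤k) =
    minW , minZ , subst (λ U → ∣ U ∣ ≤ k) (∪-comm Z W) Z∪W≤k

  Near*⇒Reach : ∀ {s k Z W} → s ≤ k → Star (Near s) Z W → Reach G k Z W
  Near*⇒Reach s≤k ε = here
  Near*⇒Reach s≤k ((minZ , minW , Z∪W≤s) ◅ rs) =
    Reach-trans (Reach-via-∪ (proj₁ minZ) (proj₁ minW) (≤-trans Z∪W≤s s≤k)) (Near*⇒Reach s≤k rs)

  Near₀*⇒≡ : ∀ {Z W} → Star (Near 0) Z W → Z ≡ W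
  Near₀*⇒≡ ε = refl
  Near₀*⇒≡ {Z} (_◅_ {j = W} (_ , _ , Z∪W≤0) rs) = trans Z≡W (Near₀*⇒≡ rs)
    where
      Z≡W : Z ≡ W
      Z≡W = ⊆-antisym (⊥-elim ∘ ∣p∣≤0⇒x∉p Z∪W≤0 ∘ p⊆p∪q W)
                      (⊥-elim ∘ ∣p∣≤0⇒x∉p Z∪W≤0 ∘ q⊆p∪q Z W)

  Linked : ℕ → Set
  Linked s = ∀ X Y → MinimalDominating G X → MinimalDominating G Y → Star (Near s) X Y

  Linked-n : Linked n
  Linked-n X Y minX minY = (minX , minY , ∣p∣≤n (X ∪ Y)) ◅ ε

  ¬Linked-0 : HasEdge G → ¬ Linked 0
  ¬Linked-0 hasEdge linked with two-minimal hasEdge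
  ... | M₁ , M₂ , min₁ , min₂ , M₁≢M₂ = M₁≢M₂ (Near₀*⇒≡ (linked M₁ M₂ min₁ min₂))

  crossing-pair : ∀ {s X Y} → Linked s → (side : Subset n → Bool) →
    MinimalDominating G X → side X ≡ true → MinimalDominating G Y → side Y ≡ false →
    ∃₂ λ Z W → MinimalDominating G Z × side Z ≡ true × MinimalDominating G W × side W ≡ false
             × ∣ Z ∪ W ∣ ≤ s
  crossing-pair {X = X} {Y} linked side minX sX minY sY
    with Star-crossing side (linked X Y minX minY) sX sY
  ... | Z , W , (minZ , minW , Z∪W≤s) , sZ , sW = Z , W , minZ , sZ , minW , sW , Z∪W≤s

  record Cut (e : ℕ) : Set where
    field
      side    : Subset n → Bool
      inside  : ∃ λ X → MinimalDominating G X × side X ≡ true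
      outside : ∃ λ Y → MinimalDominating G Y × side Y ≡ false
      far     : ∀ X Y → MinimalDominating G X → side X ≡ true →
                MinimalDominating G Y → side Y ≡ false → e < ∣ X ∪ Y ∣

  cut-or-linked : ∀ e → Cut e ⊎ Linked e
  cut-or-linked e with minimal-⊆ {⊤} (λ _ → inj₁ ∈⊤)
  ... | X₀ , minX₀ , _ with Component.component (near? e) X₀
  ...   | c , cX₀ , reach , closed
          with anySubset? (λ Y → minimalDominating? Y ×-dec (c Y ≟ᵇ false))
  ...     | yes outside = inj₁ record
    { side    = c
    ; inside  = X₀ , minX₀ , cX₀
    ; outside = outside
    ; far     = λ X Y minX cX minY cY → ≰⇒> (λ X∪Y≤e → closed X Y cX cY (minX , minY , X∪Y≤e))
    }
  ...     | no ∄ = inj₂ λ X Y minX minY →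
    reverse Near-sym (reach X (in-c X minX)) ◅◅ reach Y (in-c Y minY)
    where
      in-c : ∀ Y → MinimalDominating G Y → c Y ≡ true
      in-c Y minY with c Y in cY
      ... | true  = refl
      ... | false = ⊥-elim (∄ (Y , minY , cY))

  threshold : HasEdge G → ∃ λ e → Linked (suc e) × Cut e
  threshold hasEdge = descend n Linked-n
    where
      descend : ∀ k → Linked k → ∃ λ e → Linked (suc e) × Cut e
      descend zero    linked = ⊥-elim (¬Linked-0 hasEdge linked)
      descend (suc e) linked with cut-or-linked e
      ... | inj₁ cut     = e , linked , cut
      ... | inj₂ linked′ = descend e linked′

  Linked⇒Connected : ∀ {s k} → Linked s → s ≤ k → Connected G k
  Linked⇒Connected linked s≤k A B inA inB
    with minimal-⊆ (proj₁ inA) | minimal-⊆ (proj₁ inB)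
  ... | MA , minA , MA⊆A | MB , minB , MB⊆B =
    Reach-trans (Reach-sym inMA (Reach-⊆ MA⊆A (proj₁ minA) inA))
      (Reach-trans (Near*⇒Reach s≤k (linked MA MB minA minB)) (Reach-⊆ MB⊆B (proj₁ minB) inB))
    where
      inMA : InDk G _ MA
      inMA = proj₁ minA , ≤-trans (p⊆q⇒∣p∣≤∣q∣ MA⊆A) (proj₂ inA)

  Linked⇒sep≤ : ∀ {s π s′} → Linked s → IsSepΠ G π s′ → s′ ≤ s
  Linked⇒sep≤ linked ((X , Y , minX , πX , minY , πY , _) , least)
    with crossing-pair linked _ minX πX minY πY
  ... | Z , W , minZ , πZ , minW , πW , Z∪W≤s = ≤-trans (least Z W minZ πZ minW πW) Z∪W≤s

  module _ {e} (cut : Cut e) where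
    open Cut cut

    Cut-tight-pair : Linked (suc e) →
      ∃₂ λ Z W → MinimalDominating G Z × side Z ≡ true × MinimalDominating G W × side W ≡ false
               × ∣ Z ∪ W ∣ ≡ suc e
    Cut-tight-pair linked =
      let X , minX , sX = inside
          Y , minY , sY = outside
          Z , W , minZ , sZ , minW , sW , ∣Z∪W∣≤1+e = crossing-pair linked side minX sX minY sY
      in Z , W , minZ , sZ , minW , sW , ≤-antisym ∣Z∪W∣≤1+e (far Z W minZ sZ minW sW)

    Cut-sep : Linked (suc e) → IsSepΠ G side (suc e)
    Cut-sep linked = Cut-tight-pair linked , far

    private
      Inner : Subset n → Set
      Inner A = ∃ λ M → MinimalDominating G M × side M ≡ true × M ⊆ A

      no-straddle : ∀ {A M M′} → InDk G e A → MinimalDominating G M → side M ≡ true → M ⊆ A →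
                    MinimalDominating G M′ → side M′ ≡ false → M′ ⊆ A → ⊥
      no-straddle (_ , ∣A∣≤e) minM sM M⊆A minM′ sM′ M′⊆A =
        1+n≰n (≤-trans (far _ _ minM sM minM′ sM′) (≤-trans (p⊆q⇒∣p∣≤∣q∣ (∪-least M⊆A M′⊆A)) ∣A∣≤e))

      Reach-Inner : ∀ {A B} → Reach G e A B → InDk G e A → Inner A → Inner B
      Reach-Inner here _ inner = inner
      Reach-Inner {A} (step {B = B} inB ab p) inA (M , minM , sM , M⊆A) = Reach-Inner p inB (move ab)
        where
          move : AdjDk A B → Inner B
          move (inj₁ A+v) = M , minM , sM , ⊆-trans M⊆A (AddOne⇒⊆ A+v)
          move (inj₂ B+v) with minimal-⊆ (proj₁ inB)
          ... | M′ , minM′ , M′⊆B with side M′ in sM′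
          ...   | true  = M′ , minM′ , sM′ , M′⊆B
          ...   | false = ⊥-elim (no-straddle inA minM sM M⊆A minM′ sM′ (⊆-trans M′⊆B (AddOne⇒⊆ B+v)))

      tight-pair-InDk : ∀ {X Y} → MinimalDominating G X → MinimalDominating G Y → Y ≢ X →
                        ∣ X ∪ Y ∣ ≡ suc e → InDk G e X
      tight-pair-InDk minX minY Y≢X size =
        proj₁ minX , ≤-pred (subst (_ <_) size (minimal-∣M∣<∣M∪S∣ minX (proj₁ minY) Y≢X))

    Cut⇒¬Connected : Linked (suc e) → ¬ Connected G e
    Cut⇒¬Connected linked connected with Cut-tight-pair linked
    ... | Z , W , minZ , sZ , minW , sW , ∣Z∪W∣≡1+e =
      let M , minM , sM , M⊆W = Reach-Inner (connected Z W inZ inW) inZ (Z , minZ , sZ , ⊆-refl)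
      in no-straddle inW minM sM M⊆W minW sW ⊆-refl
      where
        Z≢W : Z ≢ W
        Z≢W Z≡W with trans (≡-sym sZ) (trans (cong side Z≡W) sW)
        ... | ()
        inZ : InDk G e Z
        inZ = tight-pair-InDk minZ minW (Z≢W ∘ ≡-sym) ∣Z∪W∣≡1+e
        inW : InDk G e W
        inW = tight-pair-InDk minW minZ Z≢W (trans (cong ∣_∣ (∪-comm W Z)) ∣Z∪W∣≡1+e)

theorem5 : ∀ {n} (G : Graph n) → HasEdge G → Σ ℕ (λ d → IsD0 G d × IsSep G d)
theorem5 G hasEdge with threshold G hasEdge
... | e , linked , cut = suc e , (connected , least) , (sep , λ _ _ → Linked⇒sep≤ G linked)
  where
    connected : ∀ k → suc e ≤ k → Connected G k
    connected _ = Linked⇒Connected G linked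

    least : ∀ d′ → (∀ k → d′ ≤ k → Connected G k) → suc e ≤ d′
    least d′ connected′ = ≰⇒> λ d′≤e → Cut⇒¬Connected G cut linked (connected′ e d′≤e)

    sep : ∃ λ π → IsSepΠ G π (suc e)
    sep = Cut.side cut , Cut-sep G cut linked
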